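{- Let $n \geq 1$ and $k \geq 3$ be integers. If the hypercube $Q_n$ has a $C_k$-decomposition, then $Q_{mn}$ has an $L_{2k}$-decomposition for every integer $m \geq 2$.
   Context: For a positive integer $n$, the hypercube $Q_n$ is the graph whose vertices are the binary strings $x_1x_2\cdots x_n$ ($x_i\in\{0,1\}$), two vertices being adjacent if and only if they differ in exactly one position. $C_k$ denotes the cycle of length $k$. For $k \geq 3$, the sunlet graph $L_{2k}$ is the graph obtained from $C_k$ by attaching one pendant edge (to a new vertex) at each vertex of the cycle. For a graph $H$, an $H$-decomposition of a graph $G$ is a collection of edge-disjoint subgraphs of $G$, each isomorphic to $H$, whose edge sets partition $E(G)$. -}

module Defs where

open import Level using (0ℓ)
open import Data.Nat using (ℕ; zero; suc; _+_)
open import Data.Bool using (Bool; _xor_; if_then_else_)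
open import Data.Fin using (Fin; toℕ)
open import Data.Vec using (Vec; []; _∷_)
open import Data.Sum using (_⊎_; inj₁; inj₂)
open import Data.Product using (_×_; Σ; ∃; ∃-syntax; _,_)
open import Data.Empty using (⊥)
open import Relation.Binary.PropositionalEquality using (_≡_)
open import Function.Definitions using (Injective)

-- A graph: a vertex type with an (irreflexive, symmetric in our instances) adjacency relation.
record Graph : Set₁ where
  field
    V   : Set
    Adj : V → V → Set
open Graph public

hamming : ∀ {n} → Vec Bool n → Vec Bool n → ℕ
hamming []       []       = 0
hamming (a ∷ x) (b ∷ y) = (if a xor b then 1 else 0) + hamming x y

Q : ℕ → Graph
Q n = record { V = Vec Bool n ; Adj = λ x y → hamming x y ≡ 1 }

CycNext : ∀ {k} → Fin k → Fin k → Set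
CycNext {k} i j = (toℕ j ≡ suc (toℕ i)) ⊎ ((suc (toℕ i) ≡ k) × (toℕ j ≡ 0))

CycAdj : ∀ {k} → Fin k → Fin k → Set
CycAdj i j = CycNext i j ⊎ CycNext j i

C : ℕ → Graph
C k = record { V = Fin k ; Adj = CycAdj }

SunAdj : ∀ {k} → Fin k ⊎ Fin k → Fin k ⊎ Fin k → Set
SunAdj (inj₁ i) (inj₁ j) = CycAdj i j
SunAdj (inj₁ i) (inj₂ j) = i ≡ j
SunAdj (inj₂ i) (inj₁ j) = i ≡ j
SunAdj (inj₂ i) (inj₂ j) = ⊥

L : ℕ → Graph   -- L k is the sunlet graph L_{2k}
L k = record { V = Fin k ⊎ Fin k ; Adj = SunAdj }

record Copy (H G : Graph) : Set where
  field
    f     : V H → V G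
    inj   : Injective _≡_ _≡_ f
    hom   : ∀ {a b} → Adj H a b → Adj G (f a) (f b)
open Copy public

EdgeOf : ∀ {H G} → Copy H G → V G → V G → Set
EdgeOf {H} c u v = ∃[ a ] ∃[ b ] (Adj H a b × f c a ≡ u × f c b ≡ v)

record Decomposition (H G : Graph) : Set where
  field
    N      : ℕ
    copy   : Fin N → Copy H G
    cover  : ∀ u v → Adj G u v → ∃[ j ] EdgeOf (copy j) u v
    disj   : ∀ u v → Adj G u v → ∀ j j' →
             EdgeOf (copy j) u v → EdgeOf (copy j') u v → j ≡ j'

-- Q (a + b) is the Cartesian product Q a □ Q b, and H-decompositions of the two factors
-- combine into one of the product (a copy of each factor's decomposition in every fibre).
-- Since m · n is a sum of terms 2 · n and at most one 3 · n, it suffices to decompose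
-- Q n □ Q n and Q n □ Q n □ Q n into sunlets.
--
-- Orient the cycles of the given C_k-decomposition of Q n.  For k ≥ 3 every edge of Q n
-- is then an arc of exactly one cycle, in exactly one direction.  In Q n □ Q n the sunlet
-- indexed by a cycle c and y ∈ Q n has rim (c a ⊕ y , y) and pendant edges in the second
-- factor; the shear (x , y) ↦ x ⊕ y maps each of its edges onto an arc c a → c (a + 1),
-- which yields both covering and disjointness.  In Q n □ Q n □ Q n the layers of odd
-- parity (in the last factor) carry these sunlets; in a layer of even parity the cycles
-- run in the first factor (sheared by the second) or in the second (sheared by the first),
-- and their pendant edges go to the neighbouring odd layers along the forward,
-- resp. backward, arcs.

module Submission where

open import Defs
open import Data.Nat using (ℕ; zero; suc; _+_; _*_; _≤_; _<?_; z≤n; s≤s)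
open import Data.Nat.Properties
  using (+-assoc; +-identityʳ; *-distribʳ-+; suc-injective; ≤-antisym; ≮⇒≥; <⇒≢; ≤-trans; m≢1+n+m)
open import Data.Bool using (Bool; true; false; not; _xor_; if_then_else_)
open import Data.Bool.Properties
  using (not-involutive; not-¬; xor-assoc; xor-comm; xor-identityʳ; xor-same; xor-inverseˡ)
open import Data.Fin using (Fin; toℕ; zero; suc; fromℕ<; fromℕ; inject₁)
open import Data.Fin.Properties
  using (toℕ<n; toℕ-fromℕ<; toℕ-injective; toℕ-fromℕ; toℕ-inject₁; +↔⊎; *↔×; 2↔Bool; 1↔⊤)
open import Data.Vec using (Vec; []; _∷_; _++_; zipWith; replicate; take; drop; tail)
open import Data.Vec.Properties
  using (zipWith-assoc; zipWith-comm; zipWith-identityʳ; ++-injective; take++drop≡id)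
open import Data.Unit using (tt)
open import Data.Product using (_×_; _,_; proj₁; proj₂; ∃-syntax; uncurry)
open import Data.Product.Function.NonDependent.Propositional using (_×-↔_)
open import Data.Sum using (_⊎_; inj₁; inj₂)
import Data.Sum as Sum
open import Data.Sum.Function.Propositional using (_⊎-↔_)
open import Data.Empty using (⊥; ⊥-elim)
open import Function using (_∘_)
open import Function.Bundles using (_↔_; mk↔ₛ′; Inverse)
open import Function.Definitions using (Injective)
open import Function.Properties.Inverse using (↔-refl; ↔-trans)
open import Relation.Nullary using (¬_; yes; no; contradiction)
open import Relation.Binary.PropositionalEquality

private
  variable
    m k : ℕ
    i j : Fin k

infixl 6 _⊕_
_⊕_ : Vec Bool m → Vec Bool m → Vec Bool m
_⊕_ = zipWith _xor_

𝟎 : Vec Bool m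
𝟎 = replicate _ false

⊕-assoc : (x y z : Vec Bool m) → x ⊕ y ⊕ z ≡ x ⊕ (y ⊕ z)
⊕-assoc = zipWith-assoc xor-assoc

⊕-comm : (x y : Vec Bool m) → x ⊕ y ≡ y ⊕ x
⊕-comm = zipWith-comm xor-comm

⊕-identityʳ : (x : Vec Bool m) → x ⊕ 𝟎 ≡ x
⊕-identityʳ = zipWith-identityʳ xor-identityʳ

⊕-same : (x : Vec Bool m) → x ⊕ x ≡ 𝟎
⊕-same []      = refl
⊕-same (a ∷ x) = cong₂ _∷_ (xor-same a) (⊕-same x)

x⊕[x⊕y]≡y : (x y : Vec Bool m) → x ⊕ (x ⊕ y) ≡ y
x⊕[x⊕y]≡y x y = begin
  x ⊕ (x ⊕ y) ≡⟨ ⊕-assoc x x y ⟨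
  x ⊕ x ⊕ y   ≡⟨ cong (_⊕ y) (⊕-same x) ⟩
  𝟎 ⊕ y       ≡⟨ ⊕-comm 𝟎 y ⟩
  y ⊕ 𝟎       ≡⟨ ⊕-identityʳ y ⟩
  y           ∎
  where open ≡-Reasoning

x⊕y⊕y≡x : (x y : Vec Bool m) → x ⊕ y ⊕ y ≡ x
x⊕y⊕y≡x x y = trans (⊕-assoc x y y) (trans (cong (x ⊕_) (⊕-same y)) (⊕-identityʳ x))

x⊕[y⊕x]≡y : (x y : Vec Bool m) → x ⊕ (y ⊕ x) ≡ y
x⊕[y⊕x]≡y x y = trans (cong (x ⊕_) (⊕-comm y x)) (x⊕[x⊕y]≡y x y)

[x⊕y]⊕x≡y : (x y : Vec Bool m) → (x ⊕ y) ⊕ x ≡ y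
[x⊕y]⊕x≡y x y = trans (⊕-comm (x ⊕ y) x) (x⊕[x⊕y]≡y x y)

[x⊕y]⊕[x⊕z]≡y⊕z : (x y z : Vec Bool m) → (x ⊕ y) ⊕ (x ⊕ z) ≡ y ⊕ z
[x⊕y]⊕[x⊕z]≡y⊕z x y z = begin
  (x ⊕ y) ⊕ (x ⊕ z) ≡⟨ cong (_⊕ (x ⊕ z)) (⊕-comm x y) ⟩
  (y ⊕ x) ⊕ (x ⊕ z) ≡⟨ ⊕-assoc y x (x ⊕ z) ⟩
  y ⊕ (x ⊕ (x ⊕ z)) ≡⟨ cong (y ⊕_) (x⊕[x⊕y]≡y x z) ⟩
  y ⊕ z             ∎
  where open ≡-Reasoning

⊕-injectiveˡ : (x : Vec Bool m) {y z : Vec Bool m} → x ⊕ y ≡ x ⊕ z → y ≡ z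
⊕-injectiveˡ x {y} {z} e = trans (sym (x⊕[x⊕y]≡y x y)) (trans (cong (x ⊕_) e) (x⊕[x⊕y]≡y x z))

⊕-injectiveʳ : (x : Vec Bool m) {y z : Vec Bool m} → y ⊕ x ≡ z ⊕ x → y ≡ z
⊕-injectiveʳ x {y} {z} e = trans (sym (x⊕y⊕y≡x y x)) (trans (cong (_⊕ x) e) (x⊕y⊕y≡x z x))

⊕-moveˡ : {c x y : Vec Bool m} → c ≡ x ⊕ y → y ≡ x ⊕ c
⊕-moveˡ {x = x} {y} e = trans (sym (x⊕[x⊕y]≡y x y)) (cong (x ⊕_) (sym e))

⊕-moveʳ : {c x y : Vec Bool m} → c ≡ x ⊕ y → x ≡ c ⊕ y
⊕-moveʳ {x = x} {y} e = trans (sym (x⊕y⊕y≡x x y)) (cong (_⊕ y) (sym e))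

parity : Vec Bool m → Bool
parity []      = false
parity (a ∷ x) = a xor parity x

extendEven extendOdd : Vec Bool m → Vec Bool (suc m)
extendEven t = parity t ∷ t
extendOdd  t = not (parity t) ∷ t

parity-extendEven : (t : Vec Bool m) → parity (extendEven t) ≡ false
parity-extendEven t = xor-same (parity t)

parity-extendOdd : (t : Vec Bool m) → parity (extendOdd t) ≡ true
parity-extendOdd t = xor-inverseˡ (parity t)

data ParityView {m} : Vec Bool (suc m) → Set where
  even : (t : Vec Bool m) → ParityView (extendEven t)
  odd  : (t : Vec Bool m) → ParityView (extendOdd t)

parityView : (w : Vec Bool (suc m)) → ParityView w
parityView (b ∷ t) = view b (parity t) refl
  where
  view : ∀ b p → parity t ≡ p → ParityView (b ∷ t)
  view false false e = subst (λ p → ParityView (p ∷ t)) e (even t)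
  view true  true  e = subst (λ p → ParityView (p ∷ t)) e (even t)
  view true  false e = subst (λ p → ParityView (not p ∷ t)) e (odd t)
  view false true  e = subst (λ p → ParityView (not p ∷ t)) e (odd t)

extendOdd≢extendEven : {t t′ : Vec Bool m} → extendOdd t ≢ extendEven t′
extendOdd≢extendEven {t = t} {t′} e
  with trans (sym (parity-extendOdd t)) (trans (cong parity e) (parity-extendEven t′))
... | ()

xor-cancelˡ : ∀ c a b → (c xor a) xor (c xor b) ≡ a xor b
xor-cancelˡ false a     b     = refl
xor-cancelˡ true  false false = refl
xor-cancelˡ true  false true  = refl
xor-cancelˡ true  true  false = refl
xor-cancelˡ true  true  true  = refl

hamming-⊕ˡ : (z x y : Vec Bool m) → hamming (z ⊕ x) (z ⊕ y) ≡ hamming x y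
hamming-⊕ˡ []      []      []      = refl
hamming-⊕ˡ (c ∷ z) (a ∷ x) (b ∷ y) =
  cong₂ _+_ (cong (if_then 1 else 0) (xor-cancelˡ c a b)) (hamming-⊕ˡ z x y)

hamming-sym : (x y : Vec Bool m) → hamming x y ≡ hamming y x
hamming-sym []      []      = refl
hamming-sym (a ∷ x) (b ∷ y) = cong₂ _+_ (cong (if_then 1 else 0) (xor-comm a b)) (hamming-sym x y)

hamming-self : (x : Vec Bool m) → hamming x x ≡ 0
hamming-self []      = refl
hamming-self (a ∷ x) rewrite xor-same a = hamming-self x

hamming≡0⇒≡ : (x y : Vec Bool m) → hamming x y ≡ 0 → x ≡ y
hamming≡0⇒≡ []          []          _ = refl
hamming≡0⇒≡ (false ∷ x) (false ∷ y) e = cong (false ∷_) (hamming≡0⇒≡ x y e)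
hamming≡0⇒≡ (true  ∷ x) (true  ∷ y) e = cong (true ∷_) (hamming≡0⇒≡ x y e)

hamming-++ : ∀ {a b} (x x′ : Vec Bool a) (y y′ : Vec Bool b) →
             hamming (x ++ y) (x′ ++ y′) ≡ hamming x x′ + hamming y y′
hamming-++ []      []       y y′ = refl
hamming-++ (a ∷ x) (b ∷ x′) y y′ =
  trans (cong (_ +_) (hamming-++ x x′ y y′)) (sym (+-assoc (if a xor b then 1 else 0) _ _))

Q-symmetric : (x y : Vec Bool m) → Adj (Q m) x y → Adj (Q m) y x
Q-symmetric x y e = trans (hamming-sym y x) e

Q-irreflexive : (x : Vec Bool m) → ¬ Adj (Q m) x x
Q-irreflexive x e with trans (sym (hamming-self x)) e
... | ()

Q-⊕ˡ : (z x y : Vec Bool m) → Adj (Q m) x y → Adj (Q m) (z ⊕ x) (z ⊕ y)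
Q-⊕ˡ z x y e = trans (hamming-⊕ˡ z x y) e

Q-⊕ʳ : (z x y : Vec Bool m) → Adj (Q m) x y → Adj (Q m) (x ⊕ z) (y ⊕ z)
Q-⊕ʳ z x y e = subst₂ (λ u v → Adj (Q _) u v) (⊕-comm z x) (⊕-comm z y) (Q-⊕ˡ z x y e)

Q-step : (y p q : Vec Bool m) → Adj (Q m) p q → Adj (Q m) y (y ⊕ (p ⊕ q))
Q-step y p q e = begin
  hamming y (y ⊕ (p ⊕ q))       ≡⟨ cong (λ z → hamming z (y ⊕ (p ⊕ q))) (⊕-identityʳ y) ⟨
  hamming (y ⊕ 𝟎) (y ⊕ (p ⊕ q)) ≡⟨ hamming-⊕ˡ y 𝟎 (p ⊕ q) ⟩
  hamming 𝟎 (p ⊕ q)             ≡⟨ cong (λ z → hamming z (p ⊕ q)) (⊕-same p) ⟨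
  hamming (p ⊕ p) (p ⊕ q)       ≡⟨ hamming-⊕ˡ p p q ⟩
  hamming p q                   ≡⟨ e ⟩
  1                             ∎
  where open ≡-Reasoning

Q-parity : (x y : Vec Bool m) → Adj (Q m) x y → parity y ≡ not (parity x)
Q-parity []      []      ()
Q-parity (a ∷ x) (b ∷ y) e with a | b
... | false | false = Q-parity x y e
... | true  | true  = cong not (Q-parity x y e)
... | false | true  rewrite hamming≡0⇒≡ x y (suc-injective e) = refl
... | true  | false rewrite hamming≡0⇒≡ x y (suc-injective e) = sym (not-involutive _)

Q-parity-≢ : (x y : Vec Bool m) → Adj (Q m) x y → parity x ≢ parity y
Q-parity-≢ x y e eq = not-¬ (sym eq) (Q-parity x y e)

-- Cartesian products

infixr 7 _□_
_□_ : Graph → Graph → Graph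
G □ H = record
  { V   = V G × V H
  ; Adj = λ where (g , h) (g′ , h′) → (Adj G g g′ × h ≡ h′) ⊎ (g ≡ g′ × Adj H h h′)
  }

□-symmetric : ∀ {G H} → (∀ g g′ → Adj G g g′ → Adj G g′ g) → (∀ h h′ → Adj H h h′ → Adj H h′ h) →
              ∀ u v → Adj (G □ H) u v → Adj (G □ H) v u
□-symmetric G-sym H-sym _ _ (inj₁ (e , eq)) = inj₁ (G-sym _ _ e , sym eq)
□-symmetric G-sym H-sym _ _ (inj₂ (eq , e)) = inj₂ (sym eq , H-sym _ _ e)

□-irreflexive : ∀ {G H} → (∀ g → ¬ Adj G g g) → (∀ h → ¬ Adj H h h) → ∀ u → ¬ Adj (G □ H) u u
□-irreflexive G-irreflexive _ (g , _) (inj₁ (e , _)) = G-irreflexive g e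
□-irreflexive _ H-irreflexive (_ , h) (inj₂ (_ , e)) = H-irreflexive h e

record _≅_ (G G′ : Graph) : Set where
  field
    to       : V G → V G′
    from     : V G′ → V G
    from-to  : ∀ u → from (to u) ≡ u
    to-from  : ∀ v → to (from v) ≡ v
    to-adj   : ∀ {u v} → Adj G u v → Adj G′ (to u) (to v)
    from-adj : ∀ {u v} → Adj G′ u v → Adj G (from u) (from v)

≅-refl : ∀ {G} → G ≅ G
≅-refl = record
  { to = λ u → u ; from = λ u → u ; from-to = λ _ → refl ; to-from = λ _ → refl
  ; to-adj = λ e → e ; from-adj = λ e → e }

m+n≡1-split : ∀ m n → m + n ≡ 1 → (m ≡ 1 × n ≡ 0) ⊎ (m ≡ 0 × n ≡ 1)
m+n≡1-split zero          n    e = inj₂ (refl , e)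
m+n≡1-split (suc zero)    zero _ = inj₁ (refl , refl)

Q-adj-++⁻ : ∀ {a b} {x x′ : Vec Bool a} {y y′ : Vec Bool b} →
           Adj (Q (a + b)) (x ++ y) (x′ ++ y′) → Adj (Q a □ Q b) (x , y) (x′ , y′)
Q-adj-++⁻ {x = x} {x′} {y} {y′} e
  with m+n≡1-split (hamming x x′) (hamming y y′) (trans (sym (hamming-++ x x′ y y′)) e)
... | inj₁ (d , d₀) = inj₁ (d , hamming≡0⇒≡ y y′ d₀)
... | inj₂ (d₀ , d) = inj₂ (hamming≡0⇒≡ x x′ d₀ , d)

Q-adj-++⁺ : ∀ {a b} {x x′ : Vec Bool a} {y y′ : Vec Bool b} →
           Adj (Q a □ Q b) (x , y) (x′ , y′) → Adj (Q (a + b)) (x ++ y) (x′ ++ y′)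
Q-adj-++⁺ {x = x} {x′} {y} (inj₁ (d , refl)) = trans (hamming-++ x x′ y y) (cong₂ _+_ d (hamming-self y))
Q-adj-++⁺ {x = x} {y = y} {y′} (inj₂ (refl , d)) = trans (hamming-++ x x y y′) (cong₂ _+_ (hamming-self x) d)

take-drop-++ : ∀ {A : Set} {a b} (x : Vec A a) (y : Vec A b) → take a (x ++ y) ≡ x × drop a (x ++ y) ≡ y
take-drop-++ {a = a} x y = ++-injective _ _ (take++drop≡id a (x ++ y))

□-≅-Q : ∀ {G H a b} → G ≅ Q a → H ≅ Q b → (G □ H) ≅ Q (a + b)
□-≅-Q {G} {H} {a} {b} φ ψ = record
  { to       = λ (g , h) → φ.to g ++ ψ.to h
  ; from     = λ u → φ.from (take a u) , ψ.from (drop a u)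
  ; from-to  = λ (g , h) → let (t , d) = take-drop-++ (φ.to g) (ψ.to h) in
                 cong₂ _,_ (trans (cong φ.from t) (φ.from-to g)) (trans (cong ψ.from d) (ψ.from-to h))
  ; to-from  = λ u → trans (cong₂ _++_ (φ.to-from (take a u)) (ψ.to-from (drop a u))) (take++drop≡id a u)
  ; to-adj   = to-adj
  ; from-adj = from-adj
  }
  where
  module φ = _≅_ φ
  module ψ = _≅_ ψ
  to-adj : ∀ {u v} → Adj (G □ H) u v →
           Adj (Q (a + b)) (φ.to (proj₁ u) ++ ψ.to (proj₂ u)) (φ.to (proj₁ v) ++ ψ.to (proj₂ v))
  to-adj {g , h} {g′ , _} (inj₁ (d , refl)) = Q-adj-++⁺ {x = φ.to g} {φ.to g′} {ψ.to h} (inj₁ (φ.to-adj d , refl))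
  to-adj {g , h} {_ , h′} (inj₂ (refl , d)) = Q-adj-++⁺ {x = φ.to g} {y = ψ.to h} {ψ.to h′} (inj₂ (refl , ψ.to-adj d))
  from-adj : ∀ {u v} → Adj (Q (a + b)) u v →
             Adj (G □ H) (φ.from (take a u) , ψ.from (drop a u)) (φ.from (take a v) , ψ.from (drop a v))
  from-adj {u} {v} e
    with Q-adj-++⁻ (subst₂ (Adj (Q (a + b))) (sym (take++drop≡id a u)) (sym (take++drop≡id a v)) e)
  ... | inj₁ (d , eq) = inj₁ (φ.from-adj d , cong ψ.from eq)
  ... | inj₂ (eq , d) = inj₂ (cong φ.from eq , ψ.from-adj d)

≅-transport : ∀ {H G G′} → G ≅ G′ → Decomposition H G → Decomposition H G′
≅-transport {H} {G} {G′} φ D = record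
  { N     = N
  ; copy  = copy′
  ; cover = λ u v e → let (j , a , b , h , ea , eb) = cover (φ.from u) (φ.from v) (φ.from-adj e) in
              j , a , b , h , trans (cong φ.to ea) (φ.to-from u) , trans (cong φ.to eb) (φ.to-from v)
  ; disj  = λ u v e j j′ p p′ → disj (φ.from u) (φ.from v) (φ.from-adj e) j j′ (pull p) (pull p′)
  }
  where
  module φ = _≅_ φ
  open Decomposition D
  copy′ : Fin N → Copy H G′
  copy′ j = record
    { f   = λ a → φ.to (f (copy j) a)
    ; inj = λ e → inj (copy j) (trans (sym (φ.from-to _)) (trans (cong φ.from e) (φ.from-to _)))
    ; hom = λ h → φ.to-adj (hom (copy j) h)
    }
  pull : ∀ {j u v} → EdgeOf (copy′ j) u v → EdgeOf (copy j) (φ.from u) (φ.from v)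
  pull (a , b , h , refl , refl) = a , b , h , sym (φ.from-to _) , sym (φ.from-to _)

Finite : Set → Set
Finite A = ∃[ N ] (Fin N ↔ A)

Fin-finite : ∀ N → Finite (Fin N)
Fin-finite N = N , ↔-refl

⊎-finite : ∀ {A B} → Finite A → Finite B → Finite (A ⊎ B)
⊎-finite (m , φ) (n , ψ) = m + n , ↔-trans +↔⊎ (φ ⊎-↔ ψ)

×-finite : ∀ {A B} → Finite A → Finite B → Finite (A × B)
×-finite (m , φ) (n , ψ) = m * n , ↔-trans *↔× (φ ×-↔ ψ)

Vec-finite : ∀ n → Finite (Vec Bool n)
Vec-finite zero    = 1 , ↔-trans 1↔⊤ (mk↔ₛ′ (λ _ → []) (λ _ → tt) (λ { [] → refl }) (λ _ → refl))
Vec-finite (suc n) with ×-finite (2 , 2↔Bool) (Vec-finite n)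
... | N , φ = N , ↔-trans φ (mk↔ₛ′ (uncurry _∷_) (λ { (b ∷ v) → b , v }) (λ { (b ∷ v) → refl }) (λ _ → refl))

family-decomposition : ∀ {H G I} → Finite I → (cp : I → Copy H G) →
  (∀ u v → Adj G u v → ∃[ i ] EdgeOf (cp i) u v) →
  (∀ u v → Adj G u v → ∀ i i′ → EdgeOf (cp i) u v → EdgeOf (cp i′) u v → i ≡ i′) →
  Decomposition H G
family-decomposition (N , φ) cp cover disj = record
  { N     = N
  ; copy  = λ j → cp (φ.to j)
  ; cover = λ u v e → let (i , p) = cover u v e in
              φ.from i , subst (λ i → EdgeOf (cp i) u v) (sym (φ.strictlyInverseˡ i)) p
  ; disj  = λ u v e j j′ p p′ →
              trans (sym (φ.strictlyInverseʳ j)) (trans (cong φ.from (disj u v e _ _ p p′)) (φ.strictlyInverseʳ j′))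
  }
  where module φ = Inverse φ

edgeOf-adj : ∀ {H G} (c : Copy H G) {u v} → EdgeOf c u v → Adj G u v
edgeOf-adj c (a , b , h , refl , refl) = hom c h

edgeOf-unique : ∀ {H G} (D : Decomposition H G) {u v} {j j′} →
  EdgeOf (Decomposition.copy D j) u v → EdgeOf (Decomposition.copy D j′) u v → j ≡ j′
edgeOf-unique D {u} {v} {j} {j′} p = Decomposition.disj D u v (edgeOf-adj (Decomposition.copy D j) p) j j′ p

module _ {H G₁ G₂ : Graph} where

  copyˡ : Copy H G₁ → V G₂ → Copy H (G₁ □ G₂)
  copyˡ c h = record
    { f   = λ a → f c a , h
    ; inj = λ e → inj c (cong proj₁ e)
    ; hom = λ e → inj₁ (hom c e , refl)
    }

  copyʳ : V G₁ → Copy H G₂ → Copy H (G₁ □ G₂)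
  copyʳ g c = record
    { f   = λ a → g , f c a
    ; inj = λ e → inj c (cong proj₂ e)
    ; hom = λ e → inj₂ (refl , hom c e)
    }

  edgeOf-copyˡ : ∀ c h {u v} → EdgeOf (copyˡ c h) u v →
                 EdgeOf c (proj₁ u) (proj₁ v) × proj₂ u ≡ h × proj₂ v ≡ h
  edgeOf-copyˡ _ _ (a , b , e , refl , refl) = (a , b , e , refl , refl) , refl , refl

  edgeOf-copyʳ : ∀ g c {u v} → EdgeOf (copyʳ g c) u v →
                 EdgeOf c (proj₂ u) (proj₂ v) × proj₁ u ≡ g × proj₁ v ≡ g
  edgeOf-copyʳ _ _ (a , b , e , refl , refl) = (a , b , e , refl , refl) , refl , refl

  □-decomposition : Finite (V G₁) → Finite (V G₂) → (∀ g → ¬ Adj G₁ g g) →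
    Decomposition H G₁ → Decomposition H G₂ → Decomposition H (G₁ □ G₂)
  □-decomposition fin₁ fin₂ irrefl D₁ D₂ =
    family-decomposition (⊎-finite (×-finite (Fin-finite D₁.N) fin₂) (×-finite fin₁ (Fin-finite D₂.N)))
      cp cover disj
    where
    module D₁ = Decomposition D₁
    module D₂ = Decomposition D₂

    cp : (Fin D₁.N × V G₂) ⊎ (V G₁ × Fin D₂.N) → Copy H (G₁ □ G₂)
    cp (inj₁ (j , h)) = copyˡ (D₁.copy j) h
    cp (inj₂ (g , j)) = copyʳ g (D₂.copy j)

    cover : ∀ u v → Adj (G₁ □ G₂) u v → ∃[ i ] EdgeOf (cp i) u v
    cover (g , h) (g′ , _) (inj₁ (e , refl)) =
      let (j , a , b , e′ , ea , eb) = D₁.cover g g′ e in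
      inj₁ (j , h) , a , b , e′ , cong (_, h) ea , cong (_, h) eb
    cover (g , h) (_ , h′) (inj₂ (refl , e)) =
      let (j , a , b , e′ , ea , eb) = D₂.cover h h′ e in
      inj₂ (g , j) , a , b , e′ , cong (g ,_) ea , cong (g ,_) eb

    disj : ∀ u v → Adj (G₁ □ G₂) u v → ∀ i i′ → EdgeOf (cp i) u v → EdgeOf (cp i′) u v → i ≡ i′
    disj u v _ (inj₁ (j , h)) (inj₁ (j′ , h′)) p p′
      with edgeOf-copyˡ (D₁.copy j) h p | edgeOf-copyˡ (D₁.copy j′) h′ p′
    ... | q , refl , _ | q′ , eq , _ = cong₂ (λ j h → inj₁ (j , h)) (edgeOf-unique D₁ q q′) eq
    disj u v _ (inj₂ (g , j)) (inj₂ (g′ , j′)) p p′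
      with edgeOf-copyʳ g (D₂.copy j) p | edgeOf-copyʳ g′ (D₂.copy j′) p′
    ... | q , refl , _ | q′ , eq , _ = cong₂ (λ g j → inj₂ (g , j)) eq (edgeOf-unique D₂ q q′)
    disj u v _ (inj₁ (j , h)) (inj₂ (g , j′)) p p′
      with edgeOf-copyˡ (D₁.copy j) h p | edgeOf-copyʳ g (D₂.copy j′) p′
    ... | q , _ | _ , eu , ev = ⊥-elim (irrefl _ (subst (Adj G₁ _) (trans ev (sym eu)) (edgeOf-adj (D₁.copy j) q)))
    disj u v _ (inj₂ (g , j)) (inj₁ (j′ , h)) p p′
      with edgeOf-copyʳ g (D₂.copy j) p | edgeOf-copyˡ (D₁.copy j′) h p′
    ... | _ , eu , ev | q , _ = ⊥-elim (irrefl _ (subst (Adj G₁ _) (trans ev (sym eu)) (edgeOf-adj (D₁.copy j′) q)))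

Q-+-decomposition : ∀ {H a b} → Decomposition H (Q a) → Decomposition H (Q b) → Decomposition H (Q (a + b))
Q-+-decomposition {a = a} {b} D₁ D₂ =
  ≅-transport (□-≅-Q ≅-refl ≅-refl) (□-decomposition (Vec-finite a) (Vec-finite b) Q-irreflexive D₁ D₂)

next : Fin k → Fin k
next {suc k} i with suc (toℕ i) <? suc k
... | yes lt = fromℕ< lt
... | no  _  = zero

cycNext-next : (i : Fin k) → CycNext i (next i)
cycNext-next {suc k} i with suc (toℕ i) <? suc k
... | yes lt = inj₁ (toℕ-fromℕ< lt)
... | no ¬lt = inj₂ (≤-antisym (toℕ<n i) (≮⇒≥ ¬lt) , refl)

cycNext-functional : ∀ {j′} → CycNext i j → CycNext i j′ → j ≡ j′
cycNext-functional (inj₁ p) (inj₁ q) = toℕ-injective (trans p (sym q))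
cycNext-functional (inj₂ (_ , p)) (inj₂ (_ , q)) = toℕ-injective (trans p (sym q))
cycNext-functional {j = j} (inj₁ p) (inj₂ (q , _)) = contradiction (trans p q) (<⇒≢ (toℕ<n j))
cycNext-functional {j′ = j′} (inj₂ (q , _)) (inj₁ p) = contradiction (trans p q) (<⇒≢ (toℕ<n j′))

cycNext-injective : ∀ {i′} → CycNext i j → CycNext i′ j → i ≡ i′
cycNext-injective (inj₁ p) (inj₁ q) = toℕ-injective (suc-injective (trans (sym p) q))
cycNext-injective (inj₂ (p , _)) (inj₂ (q , _)) = toℕ-injective (suc-injective (trans p (sym q)))
cycNext-injective (inj₁ p) (inj₂ (_ , q)) with trans (sym p) q
... | ()
cycNext-injective (inj₂ (_ , q)) (inj₁ p) with trans (sym p) q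
... | ()

cycNext⇒≡next : CycNext i j → j ≡ next i
cycNext⇒≡next {i = i} p = cycNext-functional p (cycNext-next i)

cycAdj⇒next : CycAdj i j → j ≡ next i ⊎ i ≡ next j
cycAdj⇒next (inj₁ p) = inj₁ (cycNext⇒≡next p)
cycAdj⇒next (inj₂ p) = inj₂ (cycNext⇒≡next p)

next-injective : next i ≡ next j → i ≡ j
next-injective {i = i} {j} e = cycNext-injective (cycNext-next i) (subst (CycNext j) (sym e) (cycNext-next j))

cycNext-asym : ∀ {k} {i j : Fin k} → 3 ≤ k → CycNext i j → CycNext j i → ⊥
cycNext-asym {j = j} _ (inj₁ p) (inj₁ q) = m≢1+n+m (toℕ j) (trans p (cong suc q))
cycNext-asym k≥3 (inj₁ p) (inj₂ (q , r)) = <⇒≢ k≥3 (sym (trans (sym q) (cong suc (trans p (cong suc r)))))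
cycNext-asym k≥3 (inj₂ (q , r)) (inj₁ p) = cycNext-asym k≥3 (inj₁ p) (inj₂ (q , r))
cycNext-asym k≥3 (inj₂ (q , r)) (inj₂ (q′ , _)) =
  <⇒≢ (≤-trans (s≤s (s≤s z≤n)) k≥3) (sym (trans (sym q′) (cong suc r)))

next-next≢ : 3 ≤ k → (i : Fin k) → next (next i) ≢ i
next-next≢ k≥3 i e = cycNext-asym k≥3 (cycNext-next i) (subst (CycNext (next i)) e (cycNext-next (next i)))

prev : Fin k → Fin k
prev {suc k} zero    = fromℕ k
prev {suc k} (suc i) = inject₁ i

next-prev : (i : Fin k) → next (prev i) ≡ i
next-prev i = sym (cycNext⇒≡next (cycNext-prev i))
  where
  cycNext-prev : (i : Fin k) → CycNext (prev i) i
  cycNext-prev {suc k} zero    = inj₂ (cong suc (toℕ-fromℕ k) , refl)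
  cycNext-prev {suc k} (suc i) = inj₁ (cong suc (sym (toℕ-inject₁ i)))

-- Oriented cycle decompositions

module CycleDecomposition {G : Graph} {k : ℕ} (D : Decomposition (C k) G) where

  open Decomposition D

  cyc : Fin N → Fin k → V G
  cyc j = f (copy j)

  cyc-injective : ∀ j → Injective _≡_ _≡_ (cyc j)
  cyc-injective j = inj (copy j)

  cyc-adj : ∀ j a → Adj G (cyc j a) (cyc j (next a))
  cyc-adj j a = hom (copy j) (inj₁ (cycNext-next a))

  Arc : Fin N → V G → V G → Set
  Arc j x y = ∃[ a ] (cyc j a ≡ x × cyc j (next a) ≡ y)

  arc : ∀ j a → Arc j (cyc j a) (cyc j (next a))
  arc j a = a , refl , refl

  edge⇒arc : ∀ {x y} → Adj G x y → ∃[ j ] (Arc j x y ⊎ Arc j y x)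
  edge⇒arc {x} {y} e with cover x y e
  ... | j , a , b , h , refl , refl with cycAdj⇒next h
  ...   | inj₁ refl = j , inj₁ (arc j a)
  ...   | inj₂ refl = j , inj₂ (arc j b)

  arc-unique : ∀ {j j′ x y} → Arc j x y → Arc j′ x y → j ≡ j′
  arc-unique (a , refl , refl) (a′ , ea , eb) =
    edgeOf-unique D (a , next a , inj₁ (cycNext-next a) , refl , refl)
                    (a′ , next a′ , inj₁ (cycNext-next a′) , ea , eb)

  arc-asym : 3 ≤ k → ∀ {j j′ x y} → Arc j x y → Arc j′ y x → ⊥
  arc-asym k≥3 {j} (a , refl , refl) (a′ , ea , eb)
    with edgeOf-unique D (a , next a , inj₁ (cycNext-next a) , refl , refl)
                         (next a′ , a′ , inj₂ (cycNext-next a′) , eb , ea)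
  ... | refl with cyc-injective j eb | cyc-injective j ea
  ...   | refl | a′≡next-next-a′ = next-next≢ k≥3 a′ (sym a′≡next-next-a′)

record Sunlet (G : Graph) (k : ℕ) : Set where
  field
    rim pen       : Fin k → V G
    rim-injective : Injective _≡_ _≡_ rim
    pen-injective : Injective _≡_ _≡_ pen
    rim≢pen       : ∀ a b → rim a ≢ pen b
    rim-adj       : ∀ a → Adj G (rim a) (rim (next a))
    spoke-adj     : ∀ a → Adj G (rim a) (pen a)
open Sunlet

data SunletArc {G k} (s : Sunlet G k) (u v : V G) : Set where
  rim-arc   : ∀ a → u ≡ rim s a → v ≡ rim s (next a) → SunletArc s u v
  spoke-arc : ∀ a → u ≡ rim s a → v ≡ pen s a → SunletArc s u v

module _ {G : Graph} (G-sym : ∀ u v → Adj G u v → Adj G v u) {k : ℕ} where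

  sunletCopy : Sunlet G k → Copy (L k) G
  sunletCopy s = record { f = vertex ; inj = vertex-injective ; hom = vertex-adj }
    where
    vertex : Fin k ⊎ Fin k → V G
    vertex (inj₁ a) = rim s a
    vertex (inj₂ a) = pen s a

    vertex-injective : Injective _≡_ _≡_ vertex
    vertex-injective {inj₁ a} {inj₁ b} e = cong inj₁ (rim-injective s e)
    vertex-injective {inj₁ a} {inj₂ b} e = ⊥-elim (rim≢pen s a b e)
    vertex-injective {inj₂ a} {inj₁ b} e = ⊥-elim (rim≢pen s b a (sym e))
    vertex-injective {inj₂ a} {inj₂ b} e = cong inj₂ (pen-injective s e)

    vertex-adj : ∀ {a b} → SunAdj a b → Adj G (vertex a) (vertex b)
    vertex-adj {inj₁ a} {inj₁ b} h with cycAdj⇒next h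
    ... | inj₁ refl = rim-adj s a
    ... | inj₂ refl = G-sym _ _ (rim-adj s b)
    vertex-adj {inj₁ a} {inj₂ _} refl = spoke-adj s a
    vertex-adj {inj₂ a} {inj₁ _} refl = G-sym _ _ (spoke-adj s a)

  edgeOf⇒sunletArc : ∀ (s : Sunlet G k) {u v} → EdgeOf (sunletCopy s) u v → SunletArc s u v ⊎ SunletArc s v u
  edgeOf⇒sunletArc s (inj₁ a , inj₁ b , h , eu , ev) with cycAdj⇒next h
  ... | inj₁ refl = inj₁ (rim-arc a (sym eu) (sym ev))
  ... | inj₂ refl = inj₂ (rim-arc b (sym ev) (sym eu))
  edgeOf⇒sunletArc s (inj₁ a , inj₂ _ , refl , eu , ev) = inj₁ (spoke-arc a (sym eu) (sym ev))
  edgeOf⇒sunletArc s (inj₂ a , inj₁ _ , refl , eu , ev) = inj₂ (spoke-arc a (sym ev) (sym eu))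

  sunletArc⇒edgeOf : ∀ (s : Sunlet G k) {u v} → SunletArc s u v ⊎ SunletArc s v u → EdgeOf (sunletCopy s) u v
  sunletArc⇒edgeOf s (inj₁ (rim-arc a refl refl))   = inj₁ a , inj₁ (next a) , inj₁ (cycNext-next a) , refl , refl
  sunletArc⇒edgeOf s (inj₁ (spoke-arc a refl refl)) = inj₁ a , inj₂ a , refl , refl , refl
  sunletArc⇒edgeOf s (inj₂ (rim-arc a refl refl))   = inj₁ (next a) , inj₁ a , inj₂ (cycNext-next a) , refl , refl
  sunletArc⇒edgeOf s (inj₂ (spoke-arc a refl refl)) = inj₂ a , inj₁ a , refl , refl , refl

  -- Disjointness is certified by a signature Sig i u v of the arcs u → v of sunlet i,
  -- which must determine both i and the orientation of the edge.
  sunlet-decomposition : ∀ {I} → Finite I → (s : I → Sunlet G k) →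
    (Sig : I → V G → V G → Set) →
    (∀ i {u v} → SunletArc (s i) u v → Sig i u v) →
    (∀ {i i′ u v} → Adj G u v → Sig i u v → Sig i′ u v → i ≡ i′) →
    (∀ {i i′ u v} → Adj G u v → Sig i u v → Sig i′ v u → ⊥) →
    (∀ u v → Adj G u v → ∃[ i ] (SunletArc (s i) u v ⊎ SunletArc (s i) v u)) →
    Decomposition (L k) G
  sunlet-decomposition fin s Sig sig sig-unique sig-asym cover =
    family-decomposition fin (λ i → sunletCopy (s i))
      (λ u v e → let (i , p) = cover u v e in i , sunletArc⇒edgeOf (s i) p)
      disj
    where
    disj : ∀ u v → Adj G u v → ∀ i i′ → EdgeOf (sunletCopy (s i)) u v → EdgeOf (sunletCopy (s i′)) u v → i ≡ i′
    disj u v e i i′ p p′ with edgeOf⇒sunletArc (s i) p | edgeOf⇒sunletArc (s i′) p′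
    ... | inj₁ q | inj₁ q′ = sig-unique e (sig i q) (sig i′ q′)
    ... | inj₂ q | inj₂ q′ = sig-unique (G-sym u v e) (sig i q) (sig i′ q′)
    ... | inj₁ q | inj₂ q′ = ⊥-elim (sig-asym e (sig i q) (sig i′ q′))
    ... | inj₂ q | inj₁ q′ = ⊥-elim (sig-asym e (sig i′ q′) (sig i q))

module _ {G H : Graph} {k : ℕ} where

  liftSunlet : Sunlet G k → V H → Sunlet (G □ H) k
  liftSunlet s h = record
    { rim           = λ a → rim s a , h
    ; pen           = λ a → pen s a , h
    ; rim-injective = λ e → rim-injective s (cong proj₁ e)
    ; pen-injective = λ e → pen-injective s (cong proj₁ e)
    ; rim≢pen       = λ a b e → rim≢pen s a b (cong proj₁ e)
    ; rim-adj       = λ a → inj₁ (rim-adj s a , refl)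
    ; spoke-adj     = λ a → inj₁ (spoke-adj s a , refl)
    }

  liftArc : ∀ {s h u v} → SunletArc s u v → SunletArc (liftSunlet s h) (u , h) (v , h)
  liftArc (rim-arc a refl refl)   = rim-arc a refl refl
  liftArc (spoke-arc a refl refl) = spoke-arc a refl refl

  unliftArc : ∀ {s h u v} → SunletArc (liftSunlet s h) u v →
              SunletArc s (proj₁ u) (proj₁ v) × proj₂ u ≡ h × proj₂ v ≡ h
  unliftArc (rim-arc a refl refl)   = rim-arc a refl refl , refl , refl
  unliftArc (spoke-arc a refl refl) = spoke-arc a refl refl , refl , refl

  spiked : (r : Fin k → V G) → Injective _≡_ _≡_ r → (∀ a → Adj G (r a) (r (next a))) →
           (∀ h → ¬ Adj H h h) → (h : V H) (d : Fin k → V H) → (∀ a → Adj H h (d a)) → Sunlet (G □ H) k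
  spiked r r-injective r-adj H-irreflexive h d d-adj = record
    { rim           = λ a → r a , h
    ; pen           = λ a → r a , d a
    ; rim-injective = λ e → r-injective (cong proj₁ e)
    ; pen-injective = λ e → r-injective (cong proj₁ e)
    ; rim≢pen       = λ _ b e → H-irreflexive h (subst (Adj H h) (sym (cong proj₂ e)) (d-adj b))
    ; rim-adj       = λ a → inj₁ (r-adj a , refl)
    ; spoke-adj     = λ a → inj₂ (refl , d-adj a)
    }

-- Sunlet decomposition of Q n □ Q n

module Doubling {n k : ℕ} (k≥3 : 3 ≤ k) (D : Decomposition (C k) (Q n)) where

  open Decomposition D using (N)
  open CycleDecomposition D

  P : Graph
  P = Q n □ Q n

  P-symmetric : ∀ p p′ → Adj P p p′ → Adj P p′ p
  P-symmetric = □-symmetric Q-symmetric Q-symmetric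

  shear : V P → Vec Bool n
  shear (x , y) = x ⊕ y

  δ : Fin N → Fin k → Vec Bool n
  δ j a = cyc j a ⊕ cyc j (next a)

  δ-adj : ∀ y j a → Adj (Q n) y (y ⊕ δ j a)
  δ-adj y j a = Q-step y (cyc j a) (cyc j (next a)) (cyc-adj j a)

  twisted : Fin N × Vec Bool n → Sunlet P k
  twisted (j , y) = record
    { rim           = λ a → cyc j a ⊕ y , y
    ; pen           = λ a → cyc j a ⊕ y , y ⊕ δ j a
    ; rim-injective = λ e → cyc-injective j (⊕-injectiveʳ y (cong proj₁ e))
    ; pen-injective = λ e → cyc-injective j (⊕-injectiveʳ y (cong proj₁ e))
    ; rim≢pen       = λ _ b e → Q-irreflexive y (subst (Adj (Q n) y) (sym (cong proj₂ e)) (δ-adj y j b))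
    ; rim-adj       = λ a → inj₁ (Q-⊕ʳ y (cyc j a) (cyc j (next a)) (cyc-adj j a) , refl)
    ; spoke-adj     = λ a → inj₂ (refl , δ-adj y j a)
    }

  Sig : Fin N × Vec Bool n → V P → V P → Set
  Sig (j , y) p p′ = Arc j (shear p) (shear p′) × proj₂ p ≡ y

  sig : ∀ i {p p′} → SunletArc (twisted i) p p′ → Sig i p p′
  sig (j , y) (rim-arc a refl refl)   = (a , sym (x⊕y⊕y≡x _ y) , sym (x⊕y⊕y≡x _ y)) , refl
  sig (j , y) (spoke-arc a refl refl) = (a , sym (x⊕y⊕y≡x _ y) , sym ξ-pen) , refl
    where
    ξ-pen : (cyc j a ⊕ y) ⊕ (y ⊕ δ j a) ≡ cyc j (next a)
    ξ-pen = begin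
      (cyc j a ⊕ y) ⊕ (y ⊕ δ j a) ≡⟨ ⊕-assoc (cyc j a) y (y ⊕ δ j a) ⟩
      cyc j a ⊕ (y ⊕ (y ⊕ δ j a)) ≡⟨ cong (cyc j a ⊕_) (x⊕[x⊕y]≡y y (δ j a)) ⟩
      cyc j a ⊕ δ j a             ≡⟨ x⊕[x⊕y]≡y (cyc j a) (cyc j (next a)) ⟩
      cyc j (next a)              ∎
      where open ≡-Reasoning

  sig-unique : ∀ {i i′ p p′} → Sig i p p′ → Sig i′ p p′ → i ≡ i′
  sig-unique (α , refl) (α′ , refl) = cong (_, _) (arc-unique α α′)

  sig-asym : ∀ {i i′ p p′} → Sig i p p′ → Sig i′ p′ p → ⊥
  sig-asym (α , _) (α′ , _) = arc-asym k≥3 α α′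

  untwist : ∀ {c x y : Vec Bool n} → c ≡ x ⊕ y → (x , y) ≡ (c ⊕ y , y)
  untwist {y = y} e = cong (_, y) (⊕-moveʳ e)

  rim-cover : ∀ {j x x′ y} → Arc j (x ⊕ y) (x′ ⊕ y) → SunletArc (twisted (j , y)) (x , y) (x′ , y)
  rim-cover (a , ea , eb) = rim-arc a (untwist ea) (untwist eb)

  spoke-cover : ∀ {j x y y′} → Arc j (x ⊕ y) (x ⊕ y′) → SunletArc (twisted (j , y)) (x , y) (x , y′)
  spoke-cover {j} {x} {y} {y′} (a , ea , eb) = spoke-arc a (untwist ea) (cong₂ _,_ (⊕-moveʳ ea) y′≡)
    where
    y′≡ : y′ ≡ y ⊕ δ j a
    y′≡ = begin
      y′                        ≡⟨ x⊕[x⊕y]≡y y y′ ⟨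
      y ⊕ (y ⊕ y′)              ≡⟨ cong (y ⊕_) ([x⊕y]⊕[x⊕z]≡y⊕z x y y′) ⟨
      y ⊕ ((x ⊕ y) ⊕ (x ⊕ y′))  ≡⟨ cong₂ (λ c c′ → y ⊕ (c ⊕ c′)) ea eb ⟨
      y ⊕ δ j a                 ∎
      where open ≡-Reasoning

  cover : ∀ p p′ → Adj P p p′ → ∃[ i ] (SunletArc (twisted i) p p′ ⊎ SunletArc (twisted i) p′ p)
  cover (x , y) (x′ , _) (inj₁ (e , refl)) with edge⇒arc (Q-⊕ʳ y x x′ e)
  ... | j , inj₁ α = (j , y) , inj₁ (rim-cover α)
  ... | j , inj₂ α = (j , y) , inj₂ (rim-cover α)
  cover (x , y) (_ , y′) (inj₂ (refl , e)) with edge⇒arc (Q-⊕ˡ x y y′ e)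
  ... | j , inj₁ α = (j , y) , inj₁ (spoke-cover α)
  ... | j , inj₂ α = (j , y′) , inj₂ (spoke-cover α)

  decomposition : Decomposition (L k) P
  decomposition = sunlet-decomposition P-symmetric (×-finite (Fin-finite N) (Vec-finite n)) twisted
    Sig sig (λ _ → sig-unique) (λ _ → sig-asym) cover

-- Sunlet decomposition of Q n □ Q n □ Q n

module Tripling {n′ k : ℕ} (k≥3 : 3 ≤ k) (D : Decomposition (C k) (Q (suc n′))) where

  n : ℕ
  n = suc n′

  open Decomposition D using (N)
  open CycleDecomposition D
  open Doubling k≥3 D using (P; P-symmetric; shear; δ; δ-adj; twisted; untwist)
    renaming (Sig to Sig₂; sig to sig₂; sig-unique to sig₂-unique; sig-asym to sig₂-asym; cover to cover₂)

  G : Graph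
  G = P □ Q n

  -- A height of given parity is determined by its last n′ bits.
  Key : Set
  Key = (Fin N × Vec Bool n) × Vec Bool n′

  pattern layer i    = inj₁ i
  pattern forward i  = inj₂ (inj₁ i)
  pattern backward i = inj₂ (inj₂ i)

  -- Shifted by one: the spoke at a leaves cyc j (next a) backwards along the arc a → next a.
  backRim : Fin N → Vec Bool n → Fin k → V P
  backRim j x a = x , x ⊕ cyc j (next a)

  sunlet : Key ⊎ Key ⊎ Key → Sunlet G k
  sunlet (layer ((j , y) , t)) = liftSunlet (twisted (j , y)) (extendOdd t)
  sunlet (forward ((j , y) , t)) =
    spiked (rim (twisted (j , y))) (rim-injective (twisted (j , y))) (rim-adj (twisted (j , y)))
      Q-irreflexive (extendEven t) (λ a → extendEven t ⊕ δ j a) (δ-adj (extendEven t) j)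
  sunlet (backward ((j , x) , t)) =
    spiked (backRim j x)
      (λ e → next-injective (cyc-injective j (⊕-injectiveˡ x (cong proj₂ e))))
      (λ a → inj₂ (refl , Q-⊕ˡ x (cyc j (next a)) (cyc j (next (next a))) (cyc-adj j (next a))))
      Q-irreflexive (extendEven t) (λ a → extendEven t ⊕ δ j a) (δ-adj (extendEven t) j)

  -- In a spoke, shear p ⊕ (z ⊕ z′) is shear p moved in the direction in which the spoke
  -- leaves the layer.
  Sig : Key ⊎ Key ⊎ Key → V G → V G → Set
  Sig (layer (i , t)) (p , z) (p′ , z′) = z ≡ extendOdd t × z′ ≡ z × Sig₂ i p p′
  Sig (forward ((j , y) , t)) (p , z) (p′ , z′) = z ≡ extendEven t ×
    ((Arc j (shear p) (shear p′) × proj₂ p ≡ y × proj₂ p′ ≡ y × z′ ≡ z) ⊎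
     (Arc j (shear p) (shear p ⊕ (z ⊕ z′)) × proj₂ p ≡ y × p′ ≡ p))
  Sig (backward ((j , x) , t)) (p , z) (p′ , z′) = z ≡ extendEven t ×
    ((Arc j (shear p) (shear p′) × proj₁ p ≡ x × proj₁ p′ ≡ x × z′ ≡ z) ⊎
     (Arc j (shear p ⊕ (z ⊕ z′)) (shear p) × proj₁ p ≡ x × p′ ≡ p))

  sig : ∀ i {u v} → SunletArc (sunlet i) u v → Sig i u v
  sig (layer (i , t)) q with unliftArc q
  ... | q₂ , refl , refl = refl , refl , sig₂ i q₂
  sig (forward ((j , y) , t)) (rim-arc a refl refl) =
    refl , inj₁ (proj₁ (sig₂ (j , y) (rim-arc a refl refl)) , refl , refl , refl)
  sig (forward ((j , y) , t)) (spoke-arc a refl refl) =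
    refl , inj₂ ((a , sym (x⊕y⊕y≡x _ y) , sym rises) , refl , refl)
    where
    w = extendEven t
    rises : (cyc j a ⊕ y ⊕ y) ⊕ (w ⊕ (w ⊕ δ j a)) ≡ cyc j (next a)
    rises = begin
      (cyc j a ⊕ y ⊕ y) ⊕ (w ⊕ (w ⊕ δ j a)) ≡⟨ cong₂ _⊕_ (x⊕y⊕y≡x (cyc j a) y) (x⊕[x⊕y]≡y w (δ j a)) ⟩
      cyc j a ⊕ δ j a                       ≡⟨ x⊕[x⊕y]≡y (cyc j a) (cyc j (next a)) ⟩
      cyc j (next a)                        ∎
      where open ≡-Reasoning
  sig (backward ((j , x) , t)) (rim-arc a refl refl) =
    refl , inj₁ ((next a , sym (x⊕[x⊕y]≡y x _) , sym (x⊕[x⊕y]≡y x _)) , refl , refl , refl)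
  sig (backward ((j , x) , t)) (spoke-arc a refl refl) =
    refl , inj₂ ((a , sym falls , sym (x⊕[x⊕y]≡y x _)) , refl , refl)
    where
    w = extendEven t
    falls : (x ⊕ (x ⊕ cyc j (next a))) ⊕ (w ⊕ (w ⊕ δ j a)) ≡ cyc j a
    falls = begin
      (x ⊕ (x ⊕ cyc j (next a))) ⊕ (w ⊕ (w ⊕ δ j a)) ≡⟨ cong₂ _⊕_ (x⊕[x⊕y]≡y x _) (x⊕[x⊕y]≡y w (δ j a)) ⟩
      cyc j (next a) ⊕ δ j a                         ≡⟨ x⊕[y⊕x]≡y (cyc j (next a)) (cyc j a) ⟩
      cyc j a                                        ∎
      where open ≡-Reasoning

  G-symmetric : ∀ u v → Adj G u v → Adj G v u
  G-symmetric = □-symmetric P-symmetric Q-symmetric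

  P-irreflexive : ∀ p → ¬ Adj P p p
  P-irreflexive = □-irreflexive {Q n} {Q n} Q-irreflexive Q-irreflexive

  vertical : ∀ {p z p′ z′} → Adj G (p , z) (p′ , z′) → p′ ≡ p → Adj (Q n) z z′
  vertical (inj₁ (e , _)) refl = ⊥-elim (P-irreflexive _ e)
  vertical (inj₂ (_ , e)) _    = e

  collapse : ∀ {p z p′ z′} → Adj G (p , z) (p′ , z′) → p′ ≡ p → z′ ≡ z → ⊥
  collapse {z = z} e p≡ refl = Q-irreflexive z (vertical e p≡)

  even-spokes : ∀ {p z p′ z′} {t t′ : Vec Bool n′} → Adj G (p , z) (p′ , z′) → p′ ≡ p →
                z ≡ extendEven t → z′ ≡ extendEven t′ → ⊥
  even-spokes {t = t} {t′} e p≡ refl refl =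
    Q-parity-≢ (extendEven t) (extendEven t′) (vertical e p≡)
      (trans (parity-extendEven t) (sym (parity-extendEven t′)))

  same-height : ∀ {z b b′} {t t′ : Vec Bool n′} → z ≡ b ∷ t → z ≡ b′ ∷ t′ → t ≡ t′
  same-height e e′ = cong tail (trans (sym e) e′)

  key≡ : ∀ {j j′ : Fin N} {y y′ : Vec Bool n} {t t′ : Vec Bool n′} →
         j ≡ j′ → y ≡ y′ → t ≡ t′ → ((j , y) , t) ≡ ((j′ , y′) , t′)
  key≡ refl refl refl = refl

  forward≢backward : ∀ {f b u v} → Adj G u v → Sig (forward f) u v → Sig (backward b) u v → ⊥
  forward≢backward e (_ , inj₁ (_ , y , y′ , z≡)) (_ , inj₁ (_ , x , x′ , _)) =
    collapse e (cong₂ _,_ (trans x′ (sym x)) (trans y′ (sym y))) z≡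
  forward≢backward _ (_ , inj₂ (α , _)) (_ , inj₂ (α′ , _)) = arc-asym k≥3 α α′
  forward≢backward e (_ , inj₁ (_ , _ , _ , z≡)) (_ , inj₂ (_ , _ , p≡)) = collapse e p≡ z≡
  forward≢backward e (_ , inj₂ (_ , _ , p≡)) (_ , inj₁ (_ , _ , _ , z≡)) = collapse e p≡ z≡

  forward-backward-asym : ∀ {f b u v} → Adj G u v → Sig (forward f) u v → Sig (backward b) v u → ⊥
  forward-backward-asym e (_ , inj₁ (_ , y , y′ , z≡)) (_ , inj₁ (_ , x , x′ , _)) =
    collapse e (cong₂ _,_ (trans x (sym x′)) (trans y′ (sym y))) z≡
  forward-backward-asym e (ez , inj₂ (_ , _ , p≡)) (ez′ , inj₂ _) = even-spokes e p≡ ez ez′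
  forward-backward-asym e (_ , inj₁ (_ , _ , _ , z≡)) (_ , inj₂ (_ , _ , p≡)) = collapse e (sym p≡) z≡
  forward-backward-asym e (_ , inj₂ (_ , _ , p≡)) (_ , inj₁ (_ , _ , _ , z≡)) = collapse e p≡ (sym z≡)

  sig-unique : ∀ {i i′ u v} → Adj G u v → Sig i u v → Sig i′ u v → i ≡ i′
  sig-unique {layer _} {layer _} _ (ez , _ , s) (ez′ , _ , s′) =
    cong layer (cong₂ _,_ (sig₂-unique s s′) (same-height ez ez′))
  sig-unique {layer _} {forward _}  _ (ez , _) (ez′ , _) = ⊥-elim (extendOdd≢extendEven (trans (sym ez) ez′))
  sig-unique {layer _} {backward _} _ (ez , _) (ez′ , _) = ⊥-elim (extendOdd≢extendEven (trans (sym ez) ez′))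
  sig-unique {forward _}  {layer _} _ (ez , _) (ez′ , _) = ⊥-elim (extendOdd≢extendEven (trans (sym ez′) ez))
  sig-unique {backward _} {layer _} _ (ez , _) (ez′ , _) = ⊥-elim (extendOdd≢extendEven (trans (sym ez′) ez))
  sig-unique {forward _} {forward _} _ (ez , inj₁ (α , y , _)) (ez′ , inj₁ (α′ , y′ , _)) =
    cong forward (key≡ (arc-unique α α′) (trans (sym y) y′) (same-height ez ez′))
  sig-unique {forward _} {forward _} _ (ez , inj₂ (α , y , _)) (ez′ , inj₂ (α′ , y′ , _)) =
    cong forward (key≡ (arc-unique α α′) (trans (sym y) y′) (same-height ez ez′))
  sig-unique {forward _} {forward _} e (_ , inj₁ (_ , _ , _ , z≡)) (_ , inj₂ (_ , _ , p≡)) = ⊥-elim (collapse e p≡ z≡)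
  sig-unique {forward _} {forward _} e (_ , inj₂ (_ , _ , p≡)) (_ , inj₁ (_ , _ , _ , z≡)) = ⊥-elim (collapse e p≡ z≡)
  sig-unique {backward _} {backward _} _ (ez , inj₁ (α , x , _)) (ez′ , inj₁ (α′ , x′ , _)) =
    cong backward (key≡ (arc-unique α α′) (trans (sym x) x′) (same-height ez ez′))
  sig-unique {backward _} {backward _} _ (ez , inj₂ (α , x , _)) (ez′ , inj₂ (α′ , x′ , _)) =
    cong backward (key≡ (arc-unique α α′) (trans (sym x) x′) (same-height ez ez′))
  sig-unique {backward _} {backward _} e (_ , inj₁ (_ , _ , _ , z≡)) (_ , inj₂ (_ , _ , p≡)) =
    ⊥-elim (collapse e p≡ z≡)
  sig-unique {backward _} {backward _} e (_ , inj₂ (_ , _ , p≡)) (_ , inj₁ (_ , _ , _ , z≡)) =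
    ⊥-elim (collapse e p≡ z≡)
  sig-unique {forward _} {backward _} e s s′ = ⊥-elim (forward≢backward e s s′)
  sig-unique {backward _} {forward _} e s s′ = ⊥-elim (forward≢backward e s′ s)

  sig-asym : ∀ {i i′ u v} → Adj G u v → Sig i u v → Sig i′ v u → ⊥
  sig-asym {layer _} {layer _} _ (_ , _ , s) (_ , _ , s′) = sig₂-asym s s′
  sig-asym {layer _} {forward _}  _ (ez , z≡ , _) (ez′ , _) = extendOdd≢extendEven (trans (sym (trans z≡ ez)) ez′)
  sig-asym {layer _} {backward _} _ (ez , z≡ , _) (ez′ , _) = extendOdd≢extendEven (trans (sym (trans z≡ ez)) ez′)
  sig-asym {forward _}  {layer _} _ (ez , _) (ez′ , z≡ , _) = extendOdd≢extendEven (trans (sym (trans z≡ ez′)) ez)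
  sig-asym {backward _} {layer _} _ (ez , _) (ez′ , z≡ , _) = extendOdd≢extendEven (trans (sym (trans z≡ ez′)) ez)
  sig-asym {forward _} {forward _} _ (_ , inj₁ (α , _)) (_ , inj₁ (α′ , _)) = arc-asym k≥3 α α′
  sig-asym {forward _} {forward _} e (ez , inj₂ (_ , _ , p≡)) (ez′ , inj₂ _) = even-spokes e p≡ ez ez′
  sig-asym {forward _} {forward _} e (_ , inj₁ (_ , _ , _ , z≡)) (_ , inj₂ (_ , _ , p≡)) = collapse e (sym p≡) z≡
  sig-asym {forward _} {forward _} e (_ , inj₂ (_ , _ , p≡)) (_ , inj₁ (_ , _ , _ , z≡)) = collapse e p≡ (sym z≡)
  sig-asym {backward _} {backward _} _ (_ , inj₁ (α , _)) (_ , inj₁ (α′ , _)) = arc-asym k≥3 α α′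
  sig-asym {backward _} {backward _} e (ez , inj₂ (_ , _ , p≡)) (ez′ , inj₂ _) = even-spokes e p≡ ez ez′
  sig-asym {backward _} {backward _} e (_ , inj₁ (_ , _ , _ , z≡)) (_ , inj₂ (_ , _ , p≡)) = collapse e (sym p≡) z≡
  sig-asym {backward _} {backward _} e (_ , inj₂ (_ , _ , p≡)) (_ , inj₁ (_ , _ , _ , z≡)) = collapse e p≡ (sym z≡)
  sig-asym {forward _} {backward _} e s s′ = forward-backward-asym e s s′
  sig-asym {backward _} {forward _} {u} {v} e s s′ = forward-backward-asym (G-symmetric u v e) s′ s

  forwardRim-arc : ∀ {j x x′ y t} → Arc j (x ⊕ y) (x′ ⊕ y) →
                   SunletArc (sunlet (forward ((j , y) , t))) ((x , y) , extendEven t) ((x′ , y) , extendEven t)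
  forwardRim-arc (a , ea , eb) = rim-arc a (cong (_, _) (untwist ea)) (cong (_, _) (untwist eb))

  backRim-arc : ∀ {j x y y′ t} → Arc j (x ⊕ y) (x ⊕ y′) →
                SunletArc (sunlet (backward ((j , x) , t))) ((x , y) , extendEven t) ((x , y′) , extendEven t)
  backRim-arc {j} {x} (a , ea , eb) =
    rim-arc (prev a) (cong (λ y → (x , y) , _) (⊕-moveˡ (trans (cong (cyc j) (next-prev a)) ea)))
                     (cong (λ y → (x , y) , _) (⊕-moveˡ (trans (cong (cyc j ∘ next) (next-prev a)) eb)))

  even-layer-cover : ∀ t p p′ → Adj P p p′ →
    ∃[ i ] (SunletArc (sunlet i) (p , extendEven t) (p′ , extendEven t) ⊎
            SunletArc (sunlet i) (p′ , extendEven t) (p , extendEven t))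
  even-layer-cover t (x , y) (x′ , _) (inj₁ (e , refl)) with edge⇒arc (Q-⊕ʳ y x x′ e)
  ... | j , inj₁ α = forward ((j , y) , t) , inj₁ (forwardRim-arc α)
  ... | j , inj₂ α = forward ((j , y) , t) , inj₂ (forwardRim-arc α)
  even-layer-cover t (x , y) (_ , y′) (inj₂ (refl , e)) with edge⇒arc (Q-⊕ˡ x y y′ e)
  ... | j , inj₁ α = backward ((j , x) , t) , inj₁ (backRim-arc α)
  ... | j , inj₂ α = backward ((j , x) , t) , inj₂ (backRim-arc α)

  vertical-cover : ∀ t p z′ → Adj (Q n) (extendEven t) z′ →
                   ∃[ i ] SunletArc (sunlet i) (p , extendEven t) (p , z′)
  vertical-cover t (x , y) z′ e with edge⇒arc (Q-step (x ⊕ y) w z′ e)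
    where w = extendEven t
  ... | j , inj₁ (a , ea , eb) =
    forward ((j , y) , t) , spoke-arc a (cong (_, _) (untwist ea))
      (cong₂ _,_ (untwist ea) (⊕-moveˡ (trans (cong₂ _⊕_ ea eb) (x⊕[x⊕y]≡y (x ⊕ y) _))))
  ... | j , inj₂ (a , ea , eb) =
    backward ((j , x) , t) , spoke-arc a (cong (λ y → (x , y) , _) (⊕-moveˡ eb))
      (cong₂ _,_ (cong (x ,_) (⊕-moveˡ eb)) (⊕-moveˡ (trans (cong₂ _⊕_ ea eb) ([x⊕y]⊕x≡y (x ⊕ y) _))))

  cover : ∀ u v → Adj G u v → ∃[ i ] (SunletArc (sunlet i) u v ⊎ SunletArc (sunlet i) v u)
  cover (p , z) (p′ , _) (inj₁ (e , refl)) with parityView z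
  ... | even t = even-layer-cover t p p′ e
  ... | odd t with cover₂ p p′ e
  ...   | i , q = layer (i , t) , Sum.map liftArc liftArc q
  cover (p , z) (_ , z′) (inj₂ (refl , e)) with parityView z | parityView z′
  ... | even t | _      = let (i , q) = vertical-cover t p z′ e in i , inj₁ q
  ... | odd t  | even t′ = let (i , q) = vertical-cover t′ p z (Q-symmetric z z′ e) in i , inj₂ q
  ... | odd t  | odd t′  = ⊥-elim (Q-parity-≢ z z′ e (trans (parity-extendOdd t) (sym (parity-extendOdd t′))))

  decomposition : Decomposition (L k) G
  decomposition = sunlet-decomposition G-symmetric (⊎-finite key-finite (⊎-finite key-finite key-finite))
    sunlet Sig sig sig-unique sig-asym cover
    where
    key-finite : Finite Key
    key-finite = ×-finite (×-finite (Fin-finite N) (Vec-finite n)) (Vec-finite n′)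

theorem14 : ∀ (n k : ℕ) → 1 ≤ n → 3 ≤ k →
    Decomposition (C k) (Q n) →
    ∀ (m : ℕ) → 2 ≤ m → Decomposition (L k) (Q (m * n))
theorem14 (suc n′) k _ k≥3 D = go
  where
  n = suc n′

  resize : ∀ {a b} → a ≡ b → Decomposition (L k) (Q a) → Decomposition (L k) (Q b)
  resize = subst (λ a → Decomposition (L k) (Q a))

  double : Decomposition (L k) (Q (2 * n))
  double = resize (cong (n +_) (sym (+-identityʳ n)))
    (≅-transport (□-≅-Q ≅-refl ≅-refl) (Doubling.decomposition k≥3 D))

  triple : Decomposition (L k) (Q (3 * n))
  triple = resize (trans (+-assoc n n n) (cong (λ m → n + (n + m)) (sym (+-identityʳ n))))
    (≅-transport (□-≅-Q (□-≅-Q ≅-refl ≅-refl) ≅-refl) (Tripling.decomposition k≥3 D))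

  go : ∀ m → 2 ≤ m → Decomposition (L k) (Q (m * n))
  go 1 (s≤s ())
  go 2 _ = double
  go 3 _ = triple
  go (suc (suc m@(suc (suc _)))) _ =
    resize (sym (*-distribʳ-+ n 2 m)) (Q-+-decomposition double (go m (s≤s (s≤s z≤n))))
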